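{- For all integers $k\geq 2$ and $n\geq 2$, the complete graph $K_n$ is a $\mathsf{TS}_k$-reconfiguration graph.
   Context: All graphs are finite, simple and undirected. An independent set of a graph is a set of pairwise non-adjacent vertices. For a positive integer $k$, $\mathsf{TS}_k(G)$ is the graph whose vertices are the independent sets of $G$ of size exactly $k$, where two such sets $I,J$ are adjacent iff there exist $u,v\in V(G)$ with $I\setminus J=\{u\}$, $J\setminus I=\{v\}$ and $uv\in E(G)$. A graph $F$ is a $\mathsf{TS}_k$-reconfiguration graph if there exists a graph $G$ with $F\simeq \mathsf{TS}_k(G)$. -}

module Defs where

open import Data.Nat using (ℕ)
open import Data.Fin using (Fin)
open import Data.Fin.Subset using (Subset; _∈_; _─_; ⁅_⁆; ∣_∣)
open import Data.Product using (Σ; ∃; ∃-syntax; _×_; proj₁)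
open import Relation.Binary.PropositionalEquality using (_≡_; _≢_)
open import Relation.Nullary using (¬_)
open import Function.Bundles using (_⇔_)
open import Level using (0ℓ) renaming (suc to lsuc)

record SimpleGraph : Set₁ where
  field
    order  : ℕ
    Adj    : Fin order → Fin order → Set
    sym    : ∀ {x y} → Adj x y → Adj y x
    irrefl : ∀ {x} → ¬ Adj x x

-- A graph presented on a vertex type with a chosen notion of vertex equality
-- (needed because vertices of TS_k(G) carry proof components; two such
-- vertices are the same independent set iff their underlying subsets agree).
record Graph : Set₁ where
  field
    V   : Set
    _≈_ : V → V → Set
    E   : V → V → Set

open Graph

record _≅_ (F H : Graph) : Set where
  field
    to         : V F → V H
    injective  : ∀ x y → _≈_ H (to x) (to y) → _≈_ F x y
    surjective : ∀ w → ∃[ x ] _≈_ H (to x) w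
    adj        : ∀ x y → E F x y ⇔ E H (to x) (to y)

K : ℕ → Graph
K n = record { V = Fin n ; _≈_ = _≡_ ; E = λ i j → i ≢ j }

module _ (G : SimpleGraph) where
  open SimpleGraph G

  Independent : Subset order → Set
  Independent I = ∀ x y → x ∈ I → y ∈ I → ¬ Adj x y

  IndSet : ℕ → Set
  IndSet k = Σ (Subset order) λ I → Independent I × ∣ I ∣ ≡ k

  TS : ℕ → Graph
  TS k = record
    { V   = IndSet k
    ; _≈_ = λ I J → proj₁ I ≡ proj₁ J
    ; E   = λ I J → ∃[ u ] ∃[ v ]
              ((proj₁ I ─ proj₁ J) ≡ ⁅ u ⁆ × (proj₁ J ─ proj₁ I) ≡ ⁅ v ⁆ × Adj u v)
    }

IsTSReconfigurationGraph : ℕ → Graph → Set₁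
IsTSReconfigurationGraph k F = Σ SimpleGraph λ G → F ≅ TS G k

-- Take K_n together with k − 1 isolated vertices. An independent set of size k
-- contains at most one clique vertex and at most k − 1 isolated ones, so it is
-- exactly one clique vertex plus all isolated vertices. Two such sets differ by
-- exchanging their clique vertices, which are adjacent iff they are distinct.
module Submission where

open import Defs
open import Data.Nat using (ℕ; suc; _+_; _≤_; _≥_)
open import Data.Nat.Properties using (1+n≰n; suc-injective)
open import Data.Fin using (Fin; _↑ˡ_; _≟_)
open import Data.Fin.Properties using (↑ˡ-injective)
open import Data.Fin.Subset using (Subset; _∈_; _─_; _-_; ⁅_⁆; ∣_∣; ⊥; ⊤; inside; outside)
open import Data.Fin.Subset.Properties
  using ( ∉⊥; x∈⁅x⁆; x∈⁅y⁆⇒x≡y; ∣⊥∣≡0; ∣⊤∣≡n; ∣p∣≡n⇒p≡⊤; ∣p∣≤n; ∣⁅x⁆∣≡1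
        ; p─⊤≡⊥; p─q⊆p; x∈p∧x≢y⇒x∈p-y; ⊆-antisym; nonempty?; Empty-unique )
open import Data.Vec using ([]; _∷_; _++_; splitAt)
open import Data.Vec.Properties using (lookup-++ˡ; []=⇒lookup; lookup⇒[]=; ++-injectiveˡ; zipWith-++)
open import Data.Product using (∃-syntax; _×_; _,_; proj₁)
open import Function using (_∘_)
open import Relation.Binary.PropositionalEquality
open import Relation.Nullary using (yes; no; contradiction)
open import Relation.Nullary.Decidable using (decidable-stable)
open import Function.Bundles using (mk⇔)

private
  variable
    n m : ℕ

∈-++⁺ˡ : {p : Subset n} (q : Subset m) {x : Fin n} → x ∈ p → x ↑ˡ m ∈ p ++ q
∈-++⁺ˡ {p = p} q {x} x∈p = lookup⇒[]= _ (p ++ q) (trans (lookup-++ˡ p q x) ([]=⇒lookup x∈p))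

∈-++⁻ˡ : (p : Subset n) (q : Subset m) {x : Fin n} → x ↑ˡ m ∈ p ++ q → x ∈ p
∈-++⁻ˡ p q {x} x∈p++q = lookup⇒[]= x p (trans (sym (lookup-++ˡ p q x)) ([]=⇒lookup x∈p++q))

∣p++q∣≡∣p∣+∣q∣ : (p : Subset n) (q : Subset m) → ∣ p ++ q ∣ ≡ ∣ p ∣ + ∣ q ∣
∣p++q∣≡∣p∣+∣q∣ []            q = refl
∣p++q∣≡∣p∣+∣q∣ (inside ∷ p)  q = cong suc (∣p++q∣≡∣p∣+∣q∣ p q)
∣p++q∣≡∣p∣+∣q∣ (outside ∷ p) q = ∣p++q∣≡∣p∣+∣q∣ p q

⊥++⊥≡⊥ : ∀ n → ⊥ {n} ++ ⊥ {m} ≡ ⊥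
⊥++⊥≡⊥ 0       = refl
⊥++⊥≡⊥ (suc n) = cong (outside ∷_) (⊥++⊥≡⊥ n)

⁅x⁆++⊥≡⁅x↑ˡ⁆ : (x : Fin n) → ⁅ x ⁆ ++ ⊥ {m} ≡ ⁅ x ↑ˡ m ⁆
⁅x⁆++⊥≡⁅x↑ˡ⁆ {suc n} Fin.zero = cong (inside ∷_) (⊥++⊥≡⊥ n)
⁅x⁆++⊥≡⁅x↑ˡ⁆ (Fin.suc x)      = cong (outside ∷_) (⁅x⁆++⊥≡⁅x↑ˡ⁆ x)

p─p≡⊥ : (p : Subset n) → p ─ p ≡ ⊥
p─p≡⊥ []            = refl
p─p≡⊥ (inside ∷ p)  = cong (outside ∷_) (p─p≡⊥ p)
p─p≡⊥ (outside ∷ p) = cong (outside ∷_) (p─p≡⊥ p)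

⊥≢⁅x⁆ : (x : Fin n) → ⊥ ≢ ⁅ x ⁆
⊥≢⁅x⁆ x ⊥≡⁅x⁆ = ∉⊥ (subst (x ∈_) (sym ⊥≡⁅x⁆) (x∈⁅x⁆ x))

⁅x⁆-y≡⁅x⁆ : {x y : Fin n} → x ≢ y → ⁅ x ⁆ - y ≡ ⁅ x ⁆
⁅x⁆-y≡⁅x⁆ {x = x} {y} x≢y = ⊆-antisym (p─q⊆p ⁅ x ⁆ ⁅ y ⁆) ⁅x⁆⊆⁅x⁆-y
  where
  ⁅x⁆⊆⁅x⁆-y : ∀ {z} → z ∈ ⁅ x ⁆ → z ∈ ⁅ x ⁆ - y
  ⁅x⁆⊆⁅x⁆-y z∈⁅x⁆ with refl ← x∈⁅y⁆⇒x≡y x z∈⁅x⁆ = x∈p∧x≢y⇒x∈p-y z∈⁅x⁆ x≢y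

p≡⁅x⁆ : {p : Subset n} {x : Fin n} → x ∈ p → (∀ {y} → y ∈ p → y ≡ x) → p ≡ ⁅ x ⁆
p≡⁅x⁆ {x = x} x∈p unique = ⊆-antisym
  (λ y∈p → subst (_∈ ⁅ x ⁆) (sym (unique y∈p)) (x∈⁅x⁆ x))
  (λ y∈⁅x⁆ → subst (_∈ _) (sym (x∈⁅y⁆⇒x≡y x y∈⁅x⁆)) x∈p)

completeWithIsolated : ℕ → ℕ → SimpleGraph
completeWithIsolated n m = record
  { order  = n + m
  ; Adj    = Adj
  ; sym    = λ { (a , b , refl , refl , a≢b) → b , a , refl , refl , a≢b ∘ sym }
  ; irrefl = λ { (a , b , refl , x≡b , a≢b) → a≢b (↑ˡ-injective m a b x≡b) }
  }
  where
  Adj : Fin (n + m) → Fin (n + m) → Set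
  Adj x y = ∃[ a ] ∃[ b ] x ≡ a ↑ˡ m × y ≡ b ↑ˡ m × a ≢ b

module _ (n m : ℕ) where

  private
    G : SimpleGraph
    G = completeWithIsolated n m

  withIsolated : Fin n → Subset (n + m)
  withIsolated i = ⁅ i ⁆ ++ ⊤

  withIsolated-independent : ∀ i → Independent G (withIsolated i)
  withIsolated-independent i _ _ x∈ y∈ (a , b , refl , refl , a≢b) =
    a≢b (trans (x∈⁅y⁆⇒x≡y i (∈-++⁻ˡ ⁅ i ⁆ ⊤ x∈)) (sym (x∈⁅y⁆⇒x≡y i (∈-++⁻ˡ ⁅ i ⁆ ⊤ y∈))))

  ∣withIsolated∣≡1+m : ∀ i → ∣ withIsolated i ∣ ≡ suc m
  ∣withIsolated∣≡1+m i = begin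
    ∣ ⁅ i ⁆ ++ ⊤ {m} ∣      ≡⟨ ∣p++q∣≡∣p∣+∣q∣ ⁅ i ⁆ ⊤ ⟩
    ∣ ⁅ i ⁆ ∣ + ∣ ⊤ {m} ∣   ≡⟨ cong₂ _+_ (∣⁅x⁆∣≡1 i) (∣⊤∣≡n m) ⟩
    suc m                   ∎
    where open ≡-Reasoning

  withIsolated-injective : ∀ i j → withIsolated i ≡ withIsolated j → i ≡ j
  withIsolated-injective i j eq =
    x∈⁅y⁆⇒x≡y j (subst (i ∈_) (++-injectiveˡ ⁅ i ⁆ ⁅ j ⁆ eq) (x∈⁅x⁆ i))

  withIsolated─withIsolated : ∀ {i j} → i ≢ j → withIsolated i ─ withIsolated j ≡ ⁅ i ↑ˡ m ⁆
  withIsolated─withIsolated {i} {j} i≢j = begin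
    (⁅ i ⁆ ++ ⊤) ─ (⁅ j ⁆ ++ ⊤)    ≡⟨ zipWith-++ _ ⁅ i ⁆ ⊤ ⁅ j ⁆ ⊤ ⟩
    (⁅ i ⁆ ─ ⁅ j ⁆) ++ (⊤ ─ ⊤)     ≡⟨ cong₂ _++_ (⁅x⁆-y≡⁅x⁆ i≢j) (p─⊤≡⊥ ⊤) ⟩
    ⁅ i ⁆ ++ ⊥                     ≡⟨ ⁅x⁆++⊥≡⁅x↑ˡ⁆ i ⟩
    ⁅ i ↑ˡ m ⁆                     ∎
    where open ≡-Reasoning

  independent⇒withIsolated : ∀ xs ys → Independent G (xs ++ ys) → ∣ xs ∣ + ∣ ys ∣ ≡ suc m →
                             ∃[ i ] xs ++ ys ≡ withIsolated i
  independent⇒withIsolated xs ys ind ∣xs∣+∣ys∣≡1+m with nonempty? xs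
  ... | no xs-empty = contradiction (subst (_≤ m) ∣ys∣≡1+m (∣p∣≤n ys)) 1+n≰n
    where
    ∣ys∣≡1+m : ∣ ys ∣ ≡ suc m
    ∣ys∣≡1+m = begin
      ∣ ys ∣               ≡⟨ cong (_+ ∣ ys ∣) (sym (∣⊥∣≡0 n)) ⟩
      ∣ ⊥ {n} ∣ + ∣ ys ∣   ≡⟨ cong (λ p → ∣ p ∣ + ∣ ys ∣) (sym (Empty-unique xs-empty)) ⟩
      ∣ xs ∣ + ∣ ys ∣      ≡⟨ ∣xs∣+∣ys∣≡1+m ⟩
      suc m                ∎
      where open ≡-Reasoning
  ... | yes (i , i∈xs) = i , cong₂ _++_ xs≡⁅i⁆ (∣p∣≡n⇒p≡⊤ ∣ys∣≡m)
    where
    xs≡⁅i⁆ : xs ≡ ⁅ i ⁆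
    xs≡⁅i⁆ = p≡⁅x⁆ i∈xs λ {y} y∈xs → decidable-stable (y ≟ i) λ y≢i →
      ind _ _ (∈-++⁺ˡ ys y∈xs) (∈-++⁺ˡ ys i∈xs) (y , i , refl , refl , y≢i)
    ∣ys∣≡m : ∣ ys ∣ ≡ m
    ∣ys∣≡m = suc-injective (begin
      suc ∣ ys ∣        ≡⟨ cong (_+ ∣ ys ∣) (sym (trans (cong ∣_∣ xs≡⁅i⁆) (∣⁅x⁆∣≡1 i))) ⟩
      ∣ xs ∣ + ∣ ys ∣    ≡⟨ ∣xs∣+∣ys∣≡1+m ⟩
      suc m              ∎)
      where open ≡-Reasoning

  withIsolated-indSet : Fin n → IndSet G (suc m)
  withIsolated-indSet i = withIsolated i , withIsolated-independent i , ∣withIsolated∣≡1+m i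

  TS-completeWithIsolated : K n ≅ TS G (suc m)
  TS-completeWithIsolated = record
    { to         = withIsolated-indSet
    ; injective  = withIsolated-injective
    ; surjective = surjective
    ; adj        = λ i j → mk⇔ (distinct⇒exchange i j) (exchange⇒distinct i j)
    }
    where
    surjective : (I : IndSet G (suc m)) → ∃[ i ] withIsolated i ≡ proj₁ I
    surjective (I , ind , ∣I∣≡1+m) with xs , ys , refl ← splitAt n I =
      let i , I≡ = independent⇒withIsolated xs ys ind (trans (sym (∣p++q∣≡∣p∣+∣q∣ xs ys)) ∣I∣≡1+m)
      in  i , sym I≡
    Exchange : Fin n → Fin n → Set
    Exchange i j = Graph.E (TS G (suc m)) (withIsolated-indSet i) (withIsolated-indSet j)

    distinct⇒exchange : ∀ i j → i ≢ j → Exchange i j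
    distinct⇒exchange i j i≢j =
      i ↑ˡ m , j ↑ˡ m , withIsolated─withIsolated i≢j , withIsolated─withIsolated (i≢j ∘ sym) ,
      (i , j , refl , refl , i≢j)
    exchange⇒distinct : ∀ i j → Exchange i j → i ≢ j
    exchange⇒distinct i .i (u , _ , ─≡⁅u⁆ , _) refl =
      ⊥≢⁅x⁆ u (trans (sym (p─p≡⊥ (withIsolated i))) ─≡⁅u⁆)

corollary1 : (k n : ℕ) → k ≥ 2 → n ≥ 2 → IsTSReconfigurationGraph k (K n)
corollary1 (suc m) n _ _ = completeWithIsolated n m , TS-completeWithIsolated n m
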